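{- Let $N,P$ be positive integers, let $a_{1\cdot},\ldots,a_{N\cdot}$ be integers (row local ancestry tallies) and let $\boldsymbol{\phi}_0,\boldsymbol{\phi}_1\in\mathbb{Z}^P$ (ancestry-specific allele dosages). Set $\overline{a_{n\cdot}}=a_{n\cdot}/(2P)$ for $n\in[N]$ and $f_{p,0}=\phi_{p,0}/(2N)$, $f_{p,1}=\phi_{p,1}/(2N)$ for $p\in[P]$. Then $|\mathscr{A}_{1}|>|\mathscr{A}_{2}|$ if and only if $$\frac{1}{P}\sum_{p=1}^P(f_{p,0}+f_{p,1}) > \frac{1}{2NP}\left[\sum_{p=1}^P\left(\log\binom{2N}{2N(f_{p,0}+f_{p,1})}+\log\binom{2N(f_{p,0}+f_{p,1})}{2Nf_{p,1}}\right) - \sum_{n=1}^N \log\binom{2P}{2P\overline{a_{n\cdot}}}\right],$$ where $\log$ is the base-$2$ logarithm.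
   Context: An admixed array with parameters $N,P$ is a pair $[\mathbf{A},\mathbf{X}]$ of $N\times 2P$ matrices with entries in $\{0,1\}$. Its row local ancestry tallies are $A_{n\cdot}=\sum_{p=1}^{2P}A_{np}$, and for $p\in[P]$ its ancestry-specific allele dosages are $\Phi_{p,0}=\sum_{n=1}^N[(1-A_{np})X_{np}+(1-A_{n(P+p)})X_{n(P+p)}]$ and $\Phi_{p,1}=\sum_{n=1}^N[A_{np}X_{np}+A_{n(P+p)}X_{n(P+p)}]$. $\mathscr{A}_1$ is the set of admixed arrays with $A_{n\cdot}=a_{n\cdot}$ for all $n\in[N]$; $\mathscr{A}_2$ is the set of admixed arrays with $\Phi_{p,0}=\phi_{p,0}$ and $\Phi_{p,1}=\phi_{p,1}$ for all $p\in[P]$. -}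

module Defs where

open import Data.Bool using (Bool; true; false)
open import Data.Nat using (ℕ; zero; suc; _+_; _*_; _∸_)
open import Data.Fin using (Fin; zero; suc; _↑ˡ_; _↑ʳ_)
open import Data.Vec using (Vec; []; _∷_; lookup)
open import Data.List using (List; []; _∷_; [_]; map; concatMap; cartesianProduct; filter; length)
open import Data.Product using (_×_; proj₁; proj₂)
open import Data.Fin.Properties using (all?)
open import Data.Nat.Properties using (_≟_)
open import Relation.Nullary using (Dec; _×-dec_)
open import Relation.Binary.PropositionalEquality using (_≡_)

Σ-Fin : (n : ℕ) → (Fin n → ℕ) → ℕ
Σ-Fin zero    f = 0
Σ-Fin (suc n) f = f zero + Σ-Fin n (λ i → f (suc i))

Π-Fin : (n : ℕ) → (Fin n → ℕ) → ℕ
Π-Fin zero    f = 1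
Π-Fin (suc n) f = f zero * Π-Fin n (λ i → f (suc i))

bit : Bool → ℕ
bit true  = 1
bit false = 0

-- N × 2P binary matrices: N rows, each of length P + P (= 2P);
-- column p is  p ↑ˡ P  and column P+p is  P ↑ʳ p  (p : Fin P).
Matrix : ℕ → ℕ → Set
Matrix N P = Vec (Vec Bool (P + P)) N

entry : ∀ {N} P → Matrix N P → Fin N → Fin (P + P) → ℕ
entry P M n j = bit (lookup (lookup M n) j)

Array : ℕ → ℕ → Set
Array N P = Matrix N P × Matrix N P

-- complete, duplicate-free enumeration of all vectors over a list of values
allVecs : {A : Set} → List A → (k : ℕ) → List (Vec A k)
allVecs xs zero    = [ [] ]
allVecs xs (suc k) = concatMap (λ x → map (x ∷_) (allVecs xs k)) xs

allBools : List Bool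
allBools = true ∷ false ∷ []

allMatrices : (N P : ℕ) → List (Matrix N P)
allMatrices N P = allVecs (allVecs allBools (P + P)) N

allArrays : (N P : ℕ) → List (Array N P)
allArrays N P = cartesianProduct (allMatrices N P) (allMatrices N P)

rowTally : ∀ {N P} → Array N P → Fin N → ℕ
rowTally {P = P} AX n = Σ-Fin (P + P) (λ j → entry P (proj₁ AX) n j)

Φ₀ : ∀ {N P} → Array N P → Fin P → ℕ
Φ₀ {N} {P} AX p = Σ-Fin N (λ n →
    (1 ∸ entry P A n (p ↑ˡ P)) * entry P X n (p ↑ˡ P)
  + (1 ∸ entry P A n (P ↑ʳ p)) * entry P X n (P ↑ʳ p))
  where A = proj₁ AX ; X = proj₂ AX

Φ₁ : ∀ {N P} → Array N P → Fin P → ℕ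
Φ₁ {N} {P} AX p = Σ-Fin N (λ n →
    entry P A n (p ↑ˡ P) * entry P X n (p ↑ˡ P)
  + entry P A n (P ↑ʳ p) * entry P X n (P ↑ʳ p))
  where A = proj₁ AX ; X = proj₂ AX

in𝒜₁? : ∀ {N P} (a : Fin N → ℕ) (AX : Array N P) → Dec (∀ n → rowTally {N} {P} AX n ≡ a n)
in𝒜₁? {N} {P} a AX = all? (λ n → rowTally {N} {P} AX n ≟ a n)

in𝒜₂? : ∀ {N P} (φ₀ φ₁ : Fin P → ℕ) (AX : Array N P) →
        Dec (∀ p → (Φ₀ {N} {P} AX p ≡ φ₀ p) × (Φ₁ {N} {P} AX p ≡ φ₁ p))
in𝒜₂? {N} {P} φ₀ φ₁ AX = all? (λ p → (Φ₀ {N} {P} AX p ≟ φ₀ p) ×-dec (Φ₁ {N} {P} AX p ≟ φ₁ p))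

card𝒜₁ : (N P : ℕ) → (Fin N → ℕ) → ℕ
card𝒜₁ N P a = length (filter (in𝒜₁? {N} {P} a) (allArrays N P))

card𝒜₂ : (N P : ℕ) → (Fin P → ℕ) → (Fin P → ℕ) → ℕ
card𝒜₂ N P φ₀ φ₁ = length (filter (in𝒜₂? {N} {P} φ₀ φ₁) (allArrays N P))

-- Both cardinalities factorise. An array lies in 𝒜₁ iff each row of A has the
-- prescribed tally, so |𝒜₁| = ∏ₙ C(2P, aₙ) · 2^(2NP), X being free. The dosage
-- constraints for SNP p only involve the 2N haplotype sites (ancestry, allele) of
-- columns p and P + p, so summing over the array column by column gives
-- |𝒜₂| = ∏ₚ Dₚ, where Dₚ counts sequences of 2N sites with φ₀ sites (0, 1) and
-- φ₁ sites (1, 1); the other sites carry allele 0 and a free ancestry, hence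
-- Dₚ = C(2N, φ₀ + φ₁) · C(φ₀ + φ₁, φ₁) · 2^(2N − φ₀ − φ₁). Multiplying both
-- cardinalities by 2^Σ(φ₀ + φ₁) turns |𝒜₂| < |𝒜₁| into the exponentiated form
-- of the logarithmic inequality.
{-# OPTIONS --safe #-}
module Submission where

open import Defs
open import Data.Bool using (Bool; true; false)
open import Data.Nat using (ℕ; zero; suc; _+_; _*_; _^_; _∸_; _≤_; _<_; NonZero)
open import Data.Nat.Combinatorics using (_C_; nCk+nC[k+1]≡[n+1]C[k+1]; nCn≡1)
open import Data.Nat.Tactic.RingSolver using (solve-∀)
open import Data.Nat.Properties
open import Data.Fin using (Fin; zero; suc; _↑ˡ_; _↑ʳ_)
open import Data.Fin.Properties using (all?)
open import Data.Vec as Vec using (Vec; []; _∷_; lookup)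
open import Data.Vec.Properties using (lookup-++ˡ; lookup-++ʳ; lookup-unzip)
open import Data.List using (List; []; _∷_; map; concatMap; cartesianProduct; filter; length; _++_)
open import Data.Product using (_×_; _,_; proj₁; proj₂; uncurry)
open import Function.Base using (_∘_)
open import Function.Bundles using (_⇔_; mk⇔)
open import Relation.Nullary using (Dec; does; yes; no; _×-dec_)
open import Relation.Nullary.Decidable using (does-⇔)
open import Relation.Binary.PropositionalEquality
open ≡-Reasoning
open import Algebra.Properties.CommutativeSemigroup +-commutativeSemigroup using (interchange)
open import Algebra.Properties.CommutativeSemigroup *-commutativeSemigroup using () renaming (interchange to *-interchange)

private
  variable
    A B R S : Set

-- Sums over finite enumerations

∑ : List A → (A → ℕ) → ℕ
∑ []       f = 0
∑ (x ∷ xs) f = f x + ∑ xs f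
infix 5 ∑
syntax ∑ xs (λ x → e) = ∑[ x ← xs ] e

∑-cong : ∀ (xs : List A) {f g : A → ℕ} → f ≗ g → ∑ xs f ≡ ∑ xs g
∑-cong []       f≗g = refl
∑-cong (x ∷ xs) f≗g = cong₂ _+_ (f≗g x) (∑-cong xs f≗g)

∑-zero : ∀ (xs : List A) → ∑[ _ ← xs ] 0 ≡ 0
∑-zero []       = refl
∑-zero (x ∷ xs) = ∑-zero xs

∑-++ : ∀ (xs ys : List A) f → ∑ (xs ++ ys) f ≡ ∑ xs f + ∑ ys f
∑-++ []       ys f = refl
∑-++ (x ∷ xs) ys f = trans (cong (f x +_) (∑-++ xs ys f)) (sym (+-assoc (f x) _ _))

∑-+ : ∀ (xs : List A) f g → ∑[ x ← xs ] (f x + g x) ≡ ∑ xs f + ∑ xs g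
∑-+ []       f g = refl
∑-+ (x ∷ xs) f g = trans (cong (f x + g x +_) (∑-+ xs f g)) (interchange (f x) (g x) _ _)

∑-*ˡ : ∀ (xs : List A) c f → ∑[ x ← xs ] (c * f x) ≡ c * ∑ xs f
∑-*ˡ []       c f = sym (*-zeroʳ c)
∑-*ˡ (x ∷ xs) c f = trans (cong (c * f x +_) (∑-*ˡ xs c f)) (sym (*-distribˡ-+ c (f x) _))

∑-*ʳ : ∀ (xs : List A) c f → ∑[ x ← xs ] (f x * c) ≡ ∑ xs f * c
∑-*ʳ xs c f = trans (∑-cong xs (λ x → *-comm (f x) c)) (trans (∑-*ˡ xs c f) (*-comm c _))

∑-map : ∀ (g : A → B) xs f → ∑ (map g xs) f ≡ ∑ xs (f ∘ g)
∑-map g []       f = refl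
∑-map g (x ∷ xs) f = cong (f (g x) +_) (∑-map g xs f)

∑-concatMap : ∀ (g : A → List B) xs f → ∑ (concatMap g xs) f ≡ ∑[ x ← xs ] ∑ (g x) f
∑-concatMap g []       f = refl
∑-concatMap g (x ∷ xs) f =
  trans (∑-++ (g x) (concatMap g xs) f) (cong (∑ (g x) f +_) (∑-concatMap g xs f))

∑-cartesianProduct : ∀ xs ys (f : A × B → ℕ) →
                     ∑ (cartesianProduct xs ys) f ≡ ∑[ x ← xs ] ∑[ y ← ys ] f (x , y)
∑-cartesianProduct []       ys f = refl
∑-cartesianProduct (x ∷ xs) ys f =
  trans (∑-++ (map (x ,_) ys) _ f) (cong₂ _+_ (∑-map (x ,_) ys f) (∑-cartesianProduct xs ys f))

∑-comm : ∀ xs ys (f : A → B → ℕ) → ∑[ x ← xs ] ∑[ y ← ys ] f x y ≡ ∑[ y ← ys ] ∑[ x ← xs ] f x y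
∑-comm []       ys f = sym (∑-zero ys)
∑-comm (x ∷ xs) ys f =
  trans (cong (∑ ys (f x) +_) (∑-comm xs ys f)) (sym (∑-+ ys (f x) (λ y → ∑[ x ← xs ] f x y)))

𝟙 : Dec A → ℕ
𝟙 a? = bit (does a?)

length-filter≡∑ : {P : A → Set} (P? : ∀ x → Dec (P x)) (xs : List A) →
                  length (filter P? xs) ≡ ∑[ x ← xs ] 𝟙 (P? x)
length-filter≡∑ P? []       = refl
length-filter≡∑ P? (x ∷ xs) with does (P? x)
... | true  = cong suc (length-filter≡∑ P? xs)
... | false = length-filter≡∑ P? xs

𝟙-× : (a? : Dec A) (b? : Dec B) → 𝟙 (a? ×-dec b?) ≡ 𝟙 a? * 𝟙 b?
𝟙-× (yes _) b? = sym (+-identityʳ _)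
𝟙-× (no _)  b? = refl

𝟙-all? : ∀ n {Q : Fin n → Set} (Q? : ∀ i → Dec (Q i)) → 𝟙 (all? Q?) ≡ Π-Fin n (λ i → 𝟙 (Q? i))
𝟙-all? zero        Q? = refl
𝟙-all? (suc n) {Q} Q? = begin
  𝟙 (all? Q?)                        ≡⟨ cong bit (does-⇔ ∀-suc (all? Q?) (Q? zero ×-dec all?ₛ)) ⟩
  𝟙 (Q? zero ×-dec all?ₛ)            ≡⟨ 𝟙-× (Q? zero) all?ₛ ⟩
  𝟙 (Q? zero) * 𝟙 all?ₛ              ≡⟨ cong (𝟙 (Q? zero) *_) (𝟙-all? n (λ i → Q? (suc i))) ⟩
  Π-Fin (suc n) (λ i → 𝟙 (Q? i))     ∎
  where
  all?ₛ : Dec (∀ i → Q (suc i))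
  all?ₛ = all? (λ i → Q? (suc i))
  ∀-suc : (∀ i → Q i) ⇔ (Q zero × (∀ i → Q (suc i)))
  ∀-suc = mk⇔ (λ h → h zero , h ∘ suc) (λ { (h₀ , hₛ) zero → h₀ ; (h₀ , hₛ) (suc i) → hₛ i })

Σ-Fin-cong : ∀ n {f g : Fin n → ℕ} → f ≗ g → Σ-Fin n f ≡ Σ-Fin n g
Σ-Fin-cong zero    f≗g = refl
Σ-Fin-cong (suc n) f≗g = cong₂ _+_ (f≗g zero) (Σ-Fin-cong n (f≗g ∘ suc))

Σ-Fin-+ : ∀ n (f g : Fin n → ℕ) → Σ-Fin n (λ i → f i + g i) ≡ Σ-Fin n f + Σ-Fin n g
Σ-Fin-+ zero    f g = refl
Σ-Fin-+ (suc n) f g = trans (cong (f zero + g zero +_) (Σ-Fin-+ n (f ∘ suc) (g ∘ suc)))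
                            (interchange (f zero) (g zero) _ _)

Π-Fin-cong : ∀ n {f g : Fin n → ℕ} → f ≗ g → Π-Fin n f ≡ Π-Fin n g
Π-Fin-cong zero    f≗g = refl
Π-Fin-cong (suc n) f≗g = cong₂ _*_ (f≗g zero) (Π-Fin-cong n (f≗g ∘ suc))

Π-Fin-* : ∀ n (f g : Fin n → ℕ) → Π-Fin n (λ i → f i * g i) ≡ Π-Fin n f * Π-Fin n g
Π-Fin-* zero    f g = refl
Π-Fin-* (suc n) f g = trans (cong (f zero * g zero *_) (Π-Fin-* n (f ∘ suc) (g ∘ suc)))
                            (*-interchange (f zero) (g zero) _ _)

Π-Fin-const : ∀ n c → Π-Fin n (λ _ → c) ≡ c ^ n
Π-Fin-const zero    c = refl
Π-Fin-const (suc n) c = cong (c *_) (Π-Fin-const n c)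

Π-Fin-^ : ∀ m n (f : Fin n → ℕ) → Π-Fin n (λ i → m ^ f i) ≡ m ^ Σ-Fin n f
Π-Fin-^ m zero    f = refl
Π-Fin-^ m (suc n) f = trans (cong (m ^ f zero *_) (Π-Fin-^ m n (f ∘ suc)))
                            (sym (^-distribˡ-+-* m (f zero) _))

∑ᵥ : ∀ {m} → Vec A m → (A → ℕ) → ℕ
∑ᵥ {m = m} v f = Σ-Fin m (λ k → f (lookup v k))

∑ᵥ-++ : ∀ {m n} (u : Vec A m) (v : Vec A n) f → ∑ᵥ (u Vec.++ v) f ≡ ∑ᵥ u f + ∑ᵥ v f
∑ᵥ-++ []      v f = refl
∑ᵥ-++ (x ∷ u) v f = trans (cong (f x +_) (∑ᵥ-++ u v f)) (sym (+-assoc (f x) _ _))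

∑-allVecs-suc : ∀ (xs : List A) k f →
                ∑ (allVecs xs (suc k)) f ≡ ∑[ x ← xs ] ∑[ v ← allVecs xs k ] f (x ∷ v)
∑-allVecs-suc xs k f = trans (∑-concatMap _ xs f) (∑-cong xs (λ x → ∑-map (x ∷_) (allVecs xs k) f))

∑-allVecs-1 : ∀ (xs : List A) k → ∑[ _ ← allVecs xs k ] 1 ≡ (∑[ _ ← xs ] 1) ^ k
∑-allVecs-1 xs zero    = refl
∑-allVecs-1 xs (suc k) = begin
  ∑[ _ ← allVecs xs (suc k) ] 1                 ≡⟨ ∑-allVecs-suc xs k _ ⟩
  ∑[ _ ← xs ] ∑[ _ ← allVecs xs k ] 1           ≡⟨ ∑-cong xs (λ _ → sym (*-identityˡ _)) ⟩
  ∑[ _ ← xs ] (1 * (∑[ _ ← allVecs xs k ] 1))   ≡⟨ ∑-*ʳ xs _ (λ _ → 1) ⟩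
  (∑[ _ ← xs ] 1) * (∑[ _ ← allVecs xs k ] 1)   ≡⟨ cong ((∑[ _ ← xs ] 1) *_) (∑-allVecs-1 xs k) ⟩
  (∑[ _ ← xs ] 1) ^ suc k                       ∎

∑-allVecs-++ : ∀ (xs : List A) m n f →
               ∑ (allVecs xs (m + n)) f ≡ ∑[ u ← allVecs xs m ] ∑[ v ← allVecs xs n ] f (u Vec.++ v)
∑-allVecs-++ xs zero    n f = sym (+-identityʳ _)
∑-allVecs-++ xs (suc m) n f = begin
  ∑ (allVecs xs (suc m + n)) f
    ≡⟨ ∑-allVecs-suc xs (m + n) f ⟩
  ∑[ x ← xs ] ∑[ w ← allVecs xs (m + n) ] f (x ∷ w)
    ≡⟨ ∑-cong xs (λ x → ∑-allVecs-++ xs m n (λ w → f (x ∷ w))) ⟩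
  ∑[ x ← xs ] ∑[ u ← allVecs xs m ] ∑[ v ← allVecs xs n ] f (x ∷ u Vec.++ v)
    ≡⟨ sym (∑-allVecs-suc xs m _) ⟩
  ∑[ u ← allVecs xs (suc m) ] ∑[ v ← allVecs xs n ] f (u Vec.++ v) ∎

∑-allVecs-unzip : ∀ (xs : List A) (ys : List B) k f →
                  ∑ (cartesianProduct (allVecs xs k) (allVecs ys k)) f
                  ≡ ∑[ w ← allVecs (cartesianProduct xs ys) k ] f (Vec.unzip w)
∑-allVecs-unzip xs ys zero    f = refl
∑-allVecs-unzip xs ys (suc k) f = begin
  ∑ (cartesianProduct (allVecs xs (suc k)) (allVecs ys (suc k))) f
    ≡⟨ ∑-cartesianProduct (allVecs xs (suc k)) _ f ⟩
  ∑[ u ← allVecs xs (suc k) ] ∑[ v ← allVecs ys (suc k) ] f (u , v)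
    ≡⟨ ∑-allVecs-suc xs k _ ⟩
  ∑[ x ← xs ] ∑[ u ← allVecs xs k ] ∑[ v ← allVecs ys (suc k) ] f (x ∷ u , v)
    ≡⟨ ∑-cong xs (λ x → ∑-cong (allVecs xs k) (λ u → ∑-allVecs-suc ys k _)) ⟩
  ∑[ x ← xs ] ∑[ u ← allVecs xs k ] ∑[ y ← ys ] ∑[ v ← allVecs ys k ] f (x ∷ u , y ∷ v)
    ≡⟨ ∑-cong xs (λ x → ∑-comm (allVecs xs k) ys _) ⟩
  ∑[ x ← xs ] ∑[ y ← ys ] ∑[ u ← allVecs xs k ] ∑[ v ← allVecs ys k ] f (x ∷ u , y ∷ v)
    ≡⟨ ∑-cong xs (λ x → ∑-cong ys (λ y → unzip-tail x y)) ⟩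
  ∑[ x ← xs ] ∑[ y ← ys ] ∑[ w ← allVecs (cartesianProduct xs ys) k ] f (Vec.unzip ((x , y) ∷ w))
    ≡⟨ sym (∑-cartesianProduct xs ys _) ⟩
  ∑[ z ← cartesianProduct xs ys ] ∑[ w ← allVecs (cartesianProduct xs ys) k ] f (Vec.unzip (z ∷ w))
    ≡⟨ sym (∑-allVecs-suc (cartesianProduct xs ys) k _) ⟩
  ∑[ w ← allVecs (cartesianProduct xs ys) (suc k) ] f (Vec.unzip w) ∎
  where
  unzip-tail : ∀ x y → ∑[ u ← allVecs xs k ] ∑[ v ← allVecs ys k ] f (x ∷ u , y ∷ v)
                       ≡ ∑[ w ← allVecs (cartesianProduct xs ys) k ] f (Vec.unzip ((x , y) ∷ w))
  unzip-tail x y = trans (sym (∑-cartesianProduct (allVecs xs k) _ _))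
                         (∑-allVecs-unzip xs ys k (λ (u , v) → f (x ∷ u , y ∷ v)))

joinHalves : ∀ {k} → Vec (A × A) k → Vec A (k + k)
joinHalves w = uncurry Vec._++_ (Vec.unzip w)

∑-allVecs-halves : ∀ (xs : List A) k f →
                   ∑ (allVecs xs (k + k)) f ≡ ∑[ w ← allVecs (cartesianProduct xs xs) k ] f (joinHalves w)
∑-allVecs-halves xs k f = begin
  ∑ (allVecs xs (k + k)) f
    ≡⟨ ∑-allVecs-++ xs k k f ⟩
  ∑[ u ← allVecs xs k ] ∑[ v ← allVecs xs k ] f (u Vec.++ v)
    ≡⟨ sym (∑-cartesianProduct (allVecs xs k) _ _) ⟩
  ∑[ uv ← cartesianProduct (allVecs xs k) (allVecs xs k) ] f (uncurry Vec._++_ uv)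
    ≡⟨ ∑-allVecs-unzip xs xs k _ ⟩
  ∑[ w ← allVecs (cartesianProduct xs xs) k ] f (joinHalves w) ∎

sum₂ : (A → ℕ) → A × A → ℕ
sum₂ f (x , y) = f x + f y

∑ᵥ-joinHalves : ∀ {k} (w : Vec (A × A) k) f → ∑ᵥ (joinHalves w) f ≡ ∑ᵥ w (sum₂ f)
∑ᵥ-joinHalves {k = k} w f = begin
  ∑ᵥ (joinHalves w) f
    ≡⟨ ∑ᵥ-++ (proj₁ (Vec.unzip w)) _ f ⟩
  ∑ᵥ (proj₁ (Vec.unzip w)) f + ∑ᵥ (proj₂ (Vec.unzip w)) f
    ≡⟨ cong₂ _+_ (Σ-Fin-cong k (λ i → cong (f ∘ proj₁) (lookup-unzip i w)))
                 (Σ-Fin-cong k (λ i → cong (f ∘ proj₂) (lookup-unzip i w))) ⟩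
  Σ-Fin k (λ i → f (proj₁ (lookup w i))) + Σ-Fin k (λ i → f (proj₂ (lookup w i)))
    ≡⟨ sym (Σ-Fin-+ k _ _) ⟩
  ∑ᵥ w (sum₂ f) ∎

-- rs, read through the coordinates π, enumerates the P-th power of cs.
Factorises : {R S : Set} (P : ℕ) → List R → (Fin P → R → S) → List S → Set
Factorises {S = S} P rs π cs =
  ∀ (g : Fin P → S → ℕ) → ∑[ r ← rs ] Π-Fin P (λ p → g p (π p r)) ≡ Π-Fin P (λ p → ∑ cs (g p))

allVecs-factorises : ∀ (cs : List S) P → Factorises P (allVecs cs P) (λ p v → lookup v p) cs
allVecs-factorises cs zero    g = refl
allVecs-factorises cs (suc P) g = begin
  ∑[ v ← allVecs cs (suc P) ] Π-Fin (suc P) (λ p → g p (lookup v p))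
    ≡⟨ ∑-allVecs-suc cs P _ ⟩
  ∑[ c ← cs ] ∑[ v ← allVecs cs P ] (g zero c * Π-Fin P (λ p → g (suc p) (lookup v p)))
    ≡⟨ ∑-cong cs (λ c → ∑-*ˡ (allVecs cs P) (g zero c) _) ⟩
  ∑[ c ← cs ] (g zero c * (∑[ v ← allVecs cs P ] Π-Fin P (λ p → g (suc p) (lookup v p))))
    ≡⟨ ∑-cong cs (λ c → cong (g zero c *_) (allVecs-factorises cs P (g ∘ suc))) ⟩
  ∑[ c ← cs ] (g zero c * Π-Fin P (λ p → ∑ cs (g (suc p))))
    ≡⟨ ∑-*ʳ cs _ (g zero) ⟩
  Π-Fin (suc P) (λ p → ∑ cs (g p)) ∎

columns-factorise : ∀ {P} {rs : List R} {π : Fin P → R → S} {cs} → Factorises P rs π cs →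
                    ∀ N → Factorises P (allVecs rs N) (λ p M → Vec.map (π p) M) (allVecs cs N)
columns-factorise {P = P} fac zero g = trans (+-identityʳ _) (Π-Fin-cong P (λ p → sym (+-identityʳ _)))
columns-factorise {P = P} {rs = rs} {π = π} {cs = cs} fac (suc N) g = begin
  ∑[ M ← allVecs rs (suc N) ] Π-Fin P (λ p → g p (Vec.map (π p) M))
    ≡⟨ ∑-allVecs-suc rs N _ ⟩
  ∑[ r ← rs ] ∑[ M ← allVecs rs N ] Π-Fin P (λ p → g p (π p r ∷ Vec.map (π p) M))
    ≡⟨ ∑-cong rs (λ r → columns-factorise fac N (λ p v → g p (π p r ∷ v))) ⟩
  ∑[ r ← rs ] Π-Fin P (λ p → ∑[ v ← allVecs cs N ] g p (π p r ∷ v))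
    ≡⟨ fac (λ p c → ∑[ v ← allVecs cs N ] g p (c ∷ v)) ⟩
  Π-Fin P (λ p → ∑[ c ← cs ] ∑[ v ← allVecs cs N ] g p (c ∷ v))
    ≡⟨ Π-Fin-cong P (λ p → sym (∑-allVecs-suc cs N (g p))) ⟩
  Π-Fin P (λ p → ∑ (allVecs cs (suc N)) (g p)) ∎

cell : ∀ {P} → Fin P → Vec A (P + P) × Vec B (P + P) → (A × B) × (A × B)
cell {P = P} p (u , v) =
  (lookup u (p ↑ˡ P) , lookup v (p ↑ˡ P)) , (lookup u (P ↑ʳ p) , lookup v (P ↑ʳ p))

rowPairs-factorise : ∀ (xs : List A) (ys : List B) P →
                     Factorises P (cartesianProduct (allVecs xs (P + P)) (allVecs ys (P + P))) cell
                                  (cartesianProduct (cartesianProduct xs ys) (cartesianProduct xs ys))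
rowPairs-factorise {A = A} {B = B} xs ys P g = begin
  ∑[ uv ← cartesianProduct (allVecs xs (P + P)) (allVecs ys (P + P)) ] Π-Fin P (λ p → g p (cell p uv))
    ≡⟨ ∑-allVecs-unzip xs ys (P + P) _ ⟩
  ∑[ z ← allVecs xys (P + P) ] Π-Fin P (λ p → g p (cell p (Vec.unzip z)))
    ≡⟨ ∑-allVecs-halves xys P _ ⟩
  ∑[ w ← allVecs (cartesianProduct xys xys) P ] Π-Fin P (λ p → g p (cell p (Vec.unzip (joinHalves w))))
    ≡⟨ ∑-cong (allVecs (cartesianProduct xys xys) P)
              (λ w → Π-Fin-cong P (λ p → cong (g p) (cell-unzip-joinHalves w p))) ⟩
  ∑[ w ← allVecs (cartesianProduct xys xys) P ] Π-Fin P (λ p → g p (lookup w p))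
    ≡⟨ allVecs-factorises (cartesianProduct xys xys) P g ⟩
  Π-Fin P (λ p → ∑ (cartesianProduct xys xys) (g p)) ∎
  where
  xys : List (A × B)
  xys = cartesianProduct xs ys
  cell-unzip-joinHalves : ∀ (w : Vec ((A × B) × (A × B)) P) p →
                          cell p (Vec.unzip (joinHalves w)) ≡ lookup w p
  cell-unzip-joinHalves w p = begin
    cell p (Vec.unzip (joinHalves w))
      ≡⟨ cong₂ _,_ (lookup-unzip (p ↑ˡ P) (joinHalves w)) (lookup-unzip (P ↑ʳ p) (joinHalves w)) ⟩
    lookup (l Vec.++ r) (p ↑ˡ P) , lookup (l Vec.++ r) (P ↑ʳ p)
      ≡⟨ cong₂ _,_ (lookup-++ˡ l r p) (lookup-++ʳ l r p) ⟩
    lookup l p , lookup r p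
      ≡⟨ lookup-unzip p w ⟩
    lookup w p ∎
    where
    l r : Vec (A × B) P
    l = proj₁ (Vec.unzip w)
    r = proj₂ (Vec.unzip w)

-- Counting vectors by weight and by dosage

atPred : (ℕ → ℕ) → ℕ → ℕ
atPred f zero    = 0
atPred f (suc n) = f n

C-suc : ∀ m k → suc m C k ≡ m C k + atPred (_C_ m) k
C-suc m zero    = refl
C-suc m (suc k) = trans (sym (nCk+nC[k+1]≡[n+1]C[k+1] m k)) (+-comm (m C k) _)

∑-bitVecs-weight≡C : ∀ k m → ∑[ r ← allVecs allBools k ] 𝟙 (∑ᵥ r bit ≟ m) ≡ k C m
∑-bitVecs-weight≡C zero    zero    = refl
∑-bitVecs-weight≡C zero    (suc m) = refl
∑-bitVecs-weight≡C (suc k) m = begin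
  ∑[ r ← allVecs allBools (suc k) ] 𝟙 (∑ᵥ r bit ≟ m)
    ≡⟨ ∑-allVecs-suc allBools k _ ⟩
  (∑[ r ← allVecs allBools k ] 𝟙 (suc (∑ᵥ r bit) ≟ m))
    + ((∑[ r ← allVecs allBools k ] 𝟙 (∑ᵥ r bit ≟ m)) + 0)
    ≡⟨ cong₂ _+_ (leadingOne m) (trans (+-identityʳ _) (∑-bitVecs-weight≡C k m)) ⟩
  atPred (_C_ k) m + k C m
    ≡⟨ trans (+-comm _ (k C m)) (sym (C-suc k m)) ⟩
  suc k C m ∎
  where
  leadingOne : ∀ m → ∑[ r ← allVecs allBools k ] 𝟙 (suc (∑ᵥ r bit) ≟ m) ≡ atPred (_C_ k) m
  leadingOne zero    = ∑-zero (allVecs allBools k)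
  leadingOne (suc m) = ∑-bitVecs-weight≡C k m

-- A haplotype site is a pair (local ancestry, allele).
dosage₀ dosage₁ : Bool × Bool → ℕ
dosage₀ (a , x) = (1 ∸ bit a) * bit x
dosage₁ (a , x) = bit a * bit x

sites : List (Bool × Bool)
sites = cartesianProduct allBools allBools

dosageCount : ℕ → ℕ → ℕ → ℕ
dosageCount m i j = ∑[ v ← allVecs sites m ] 𝟙 (∑ᵥ v dosage₀ ≟ i) * 𝟙 (∑ᵥ v dosage₁ ≟ j)

-- The first site is (1,1), (1,0), (0,1) or (0,0); only (0,1) and (1,1) carry a dosage.
dosageCount-suc : ∀ m i j → dosageCount (suc m) i j
                  ≡ 2 * dosageCount m i j + atPred (λ i′ → dosageCount m i′ j) i + atPred (dosageCount m i) j
dosageCount-suc m i j = begin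
  dosageCount (suc m) i j
    ≡⟨ ∑-allVecs-suc sites m _ ⟩
  headDosage₁ + (dosageCount m i j + (headDosage₀ + (dosageCount m i j + 0)))
    ≡⟨ rearrange headDosage₁ (dosageCount m i j) headDosage₀ ⟩
  2 * dosageCount m i j + headDosage₀ + headDosage₁
    ≡⟨ cong₂ (λ y z → 2 * dosageCount m i j + y + z) (headDosage₀≡ i) (headDosage₁≡ j) ⟩
  2 * dosageCount m i j + atPred (λ i′ → dosageCount m i′ j) i + atPred (dosageCount m i) j ∎
  where
  headDosage₀ headDosage₁ : ℕ
  headDosage₀ = ∑[ v ← allVecs sites m ] 𝟙 (suc (∑ᵥ v dosage₀) ≟ i) * 𝟙 (∑ᵥ v dosage₁ ≟ j)
  headDosage₁ = ∑[ v ← allVecs sites m ] 𝟙 (∑ᵥ v dosage₀ ≟ i) * 𝟙 (suc (∑ᵥ v dosage₁) ≟ j)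
  rearrange : ∀ x d y → x + (d + (y + (d + 0))) ≡ 2 * d + y + x
  rearrange = solve-∀
  headDosage₀≡ : ∀ i → ∑[ v ← allVecs sites m ] 𝟙 (suc (∑ᵥ v dosage₀) ≟ i) * 𝟙 (∑ᵥ v dosage₁ ≟ j)
                       ≡ atPred (λ i′ → dosageCount m i′ j) i
  headDosage₀≡ zero    = ∑-zero (allVecs sites m)
  headDosage₀≡ (suc i) = refl
  headDosage₁≡ : ∀ j → ∑[ v ← allVecs sites m ] 𝟙 (∑ᵥ v dosage₀ ≟ i) * 𝟙 (suc (∑ᵥ v dosage₁) ≟ j)
                       ≡ atPred (dosageCount m i) j
  headDosage₁≡ zero    = trans (∑-cong (allVecs sites m) (λ v → *-zeroʳ (𝟙 (∑ᵥ v dosage₀ ≟ i))))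
                               (∑-zero (allVecs sites m))
  headDosage₁≡ (suc j) = refl

trinomial : ℕ → ℕ → ℕ → ℕ
trinomial m i j = (m C (i + j)) * ((i + j) C j)

trinomial-suc : ∀ m i j → trinomial (suc m) i j
                ≡ trinomial m i j + atPred (λ i′ → trinomial m i′ j) i + atPred (trinomial m i) j
trinomial-suc m i j = begin
  trinomial (suc m) i j
    ≡⟨ cong (_* ((i + j) C j)) (C-suc m (i + j)) ⟩
  ((m C (i + j)) + atPred (_C_ m) (i + j)) * ((i + j) C j)
    ≡⟨ *-distribʳ-+ ((i + j) C j) (m C (i + j)) _ ⟩
  trinomial m i j + atPred (_C_ m) (i + j) * ((i + j) C j)
    ≡⟨ cong (trinomial m i j +_) (shifts i j) ⟩
  trinomial m i j + (atPred (λ i′ → trinomial m i′ j) i + atPred (trinomial m i) j)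
    ≡⟨ sym (+-assoc (trinomial m i j) _ _) ⟩
  trinomial m i j + atPred (λ i′ → trinomial m i′ j) i + atPred (trinomial m i) j ∎
  where
  shifts : ∀ i j → atPred (_C_ m) (i + j) * ((i + j) C j)
                   ≡ atPred (λ i′ → trinomial m i′ j) i + atPred (trinomial m i) j
  shifts zero    zero    = refl
  shifts zero    (suc j) = cong ((m C j) *_) (trans (nCn≡1 (suc j)) (sym (nCn≡1 j)))
  shifts (suc i) zero    = sym (+-identityʳ _)
  shifts (suc i) (suc j) = begin
    (m C t) * (suc t C suc j)                       ≡⟨ cong ((m C t) *_) (C-suc t (suc j)) ⟩
    (m C t) * (t C suc j + t C j)                   ≡⟨ *-distribˡ-+ (m C t) _ _ ⟩
    trinomial m i (suc j) + (m C t) * (t C j)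
      ≡⟨ cong (λ s → trinomial m i (suc j) + (m C s) * (s C j)) (+-suc i j) ⟩
    trinomial m i (suc j) + trinomial m (suc i) j   ∎
    where
    t : ℕ
    t = i + suc j

-- Multiplied by 2 ^ (i + j), so that the 2 ^ (m − i − j) free ancestries need no truncated subtraction.
dosageCount-closed : ∀ m i j → dosageCount m i j * 2 ^ (i + j) ≡ trinomial m i j * 2 ^ m
dosageCount-closed zero    zero    zero    = refl
dosageCount-closed zero    zero    (suc j) = refl
dosageCount-closed zero    (suc i) j       = refl
dosageCount-closed (suc m) i j = begin
  dosageCount (suc m) i j * 2 ^ (i + j)
    ≡⟨ cong (_* 2 ^ (i + j)) (dosageCount-suc m i j) ⟩
  (2 * dosageCount m i j + atPred (λ i′ → dosageCount m i′ j) i + atPred (dosageCount m i) j) * 2 ^ (i + j)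
    ≡⟨ distrib (dosageCount m i j) _ _ (2 ^ (i + j)) ⟩
  2 * (dosageCount m i j * 2 ^ (i + j)) + atPred (λ i′ → dosageCount m i′ j) i * 2 ^ (i + j)
    + atPred (dosageCount m i) j * 2 ^ (i + j)
    ≡⟨ cong₂ _+_ (cong₂ _+_ (cong (2 *_) (dosageCount-closed m i j)) (shift₀ i)) (shift₁ j) ⟩
  2 * (trinomial m i j * 2 ^ m) + 2 * (atPred (λ i′ → trinomial m i′ j) i * 2 ^ m)
    + 2 * (atPred (trinomial m i) j * 2 ^ m)
    ≡⟨ factor (trinomial m i j) _ _ (2 ^ m) ⟩
  (trinomial m i j + atPred (λ i′ → trinomial m i′ j) i + atPred (trinomial m i) j) * 2 ^ suc m
    ≡⟨ cong (_* 2 ^ suc m) (sym (trinomial-suc m i j)) ⟩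
  trinomial (suc m) i j * 2 ^ suc m ∎
  where
  distrib : ∀ d x y e → (2 * d + x + y) * e ≡ 2 * (d * e) + x * e + y * e
  distrib = solve-∀
  factor : ∀ t x y e → 2 * (t * e) + 2 * (x * e) + 2 * (y * e) ≡ (t + x + y) * (2 * e)
  factor = solve-∀
  double : ∀ x e → x * (2 * e) ≡ 2 * (x * e)
  double = solve-∀
  shift₀ : ∀ i → atPred (λ i′ → dosageCount m i′ j) i * 2 ^ (i + j)
                 ≡ 2 * (atPred (λ i′ → trinomial m i′ j) i * 2 ^ m)
  shift₀ zero    = refl
  shift₀ (suc i) = trans (double (dosageCount m i j) _) (cong (2 *_) (dosageCount-closed m i j))
  shift₁ : ∀ j → atPred (dosageCount m i) j * 2 ^ (i + j) ≡ 2 * (atPred (trinomial m i) j * 2 ^ m)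
  shift₁ zero    = refl
  shift₁ (suc j) = begin
    dosageCount m i j * 2 ^ (i + suc j)   ≡⟨ cong (λ e → dosageCount m i j * 2 ^ e) (+-suc i j) ⟩
    dosageCount m i j * (2 * 2 ^ (i + j)) ≡⟨ double (dosageCount m i j) _ ⟩
    2 * (dosageCount m i j * 2 ^ (i + j)) ≡⟨ cong (2 *_) (dosageCount-closed m i j) ⟩
    2 * (trinomial m i j * 2 ^ m)         ∎

dosageCount-halves : ∀ N i j →
  ∑[ w ← allVecs (cartesianProduct sites sites) N ] 𝟙 (∑ᵥ w (sum₂ dosage₀) ≟ i) * 𝟙 (∑ᵥ w (sum₂ dosage₁) ≟ j)
  ≡ dosageCount (N + N) i j
dosageCount-halves N i j = sym (trans (∑-allVecs-halves sites N _)
  (∑-cong (allVecs (cartesianProduct sites sites) N) (λ w →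
     cong₂ (λ s t → 𝟙 (s ≟ i) * 𝟙 (t ≟ j)) (∑ᵥ-joinHalves w dosage₀) (∑ᵥ-joinHalves w dosage₁))))

-- Admixed arrays

Φ₀-unzip : ∀ {N P} (W : Vec (Vec Bool (P + P) × Vec Bool (P + P)) N) p →
           Φ₀ {N} {P} (Vec.unzip W) p ≡ ∑ᵥ (Vec.map (cell p) W) (sum₂ dosage₀)
Φ₀-unzip []      p = refl
Φ₀-unzip (r ∷ W) p = cong (sum₂ dosage₀ (cell p r) +_) (Φ₀-unzip W p)

Φ₁-unzip : ∀ {N P} (W : Vec (Vec Bool (P + P) × Vec Bool (P + P)) N) p →
           Φ₁ {N} {P} (Vec.unzip W) p ≡ ∑ᵥ (Vec.map (cell p) W) (sum₂ dosage₁)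
Φ₁-unzip []      p = refl
Φ₁-unzip (r ∷ W) p = cong (sum₂ dosage₁ (cell p r) +_) (Φ₁-unzip W p)

card𝒜₂≡ : ∀ N P φ₀ φ₁ → card𝒜₂ N P φ₀ φ₁ ≡ Π-Fin P (λ p → dosageCount (N + N) (φ₀ p) (φ₁ p))
card𝒜₂≡ N P φ₀ φ₁ = begin
  card𝒜₂ N P φ₀ φ₁
    ≡⟨ length-filter≡∑ (in𝒜₂? {N} {P} φ₀ φ₁) (allArrays N P) ⟩
  ∑[ AX ← allArrays N P ] 𝟙 (in𝒜₂? {N} {P} φ₀ φ₁ AX)
    ≡⟨ ∑-allVecs-unzip rows rows N _ ⟩
  ∑[ W ← allVecs rowPairs N ] 𝟙 (in𝒜₂? {N} {P} φ₀ φ₁ (Vec.unzip W))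
    ≡⟨ ∑-cong (allVecs rowPairs N) (λ W → trans (𝟙-all? P _) (Π-Fin-cong P (in𝒜₂-column W))) ⟩
  ∑[ W ← allVecs rowPairs N ] Π-Fin P (λ p → matches p (Vec.map (cell p) W))
    ≡⟨ columns-factorise (rowPairs-factorise allBools allBools P) N matches ⟩
  Π-Fin P (λ p → ∑ (allVecs (cartesianProduct sites sites) N) (matches p))
    ≡⟨ Π-Fin-cong P (λ p → dosageCount-halves N (φ₀ p) (φ₁ p)) ⟩
  Π-Fin P (λ p → dosageCount (N + N) (φ₀ p) (φ₁ p)) ∎
  where
  rows : List (Vec Bool (P + P))
  rows = allVecs allBools (P + P)
  rowPairs : List (Vec Bool (P + P) × Vec Bool (P + P))
  rowPairs = cartesianProduct rows rows
  matches : Fin P → Vec ((Bool × Bool) × (Bool × Bool)) N → ℕ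
  matches p w = 𝟙 (∑ᵥ w (sum₂ dosage₀) ≟ φ₀ p) * 𝟙 (∑ᵥ w (sum₂ dosage₁) ≟ φ₁ p)
  in𝒜₂-column : ∀ W p → 𝟙 ((Φ₀ {N} {P} (Vec.unzip W) p ≟ φ₀ p) ×-dec (Φ₁ {N} {P} (Vec.unzip W) p ≟ φ₁ p))
                         ≡ matches p (Vec.map (cell p) W)
  in𝒜₂-column W p =
    trans (𝟙-× (Φ₀ {N} {P} (Vec.unzip W) p ≟ φ₀ p) (Φ₁ {N} {P} (Vec.unzip W) p ≟ φ₁ p))
          (cong₂ (λ s t → 𝟙 (s ≟ φ₀ p) * 𝟙 (t ≟ φ₁ p)) (Φ₀-unzip W p) (Φ₁-unzip W p))

card𝒜₂-scaled : ∀ N P φ₀ φ₁ → card𝒜₂ N P φ₀ φ₁ * 2 ^ Σ-Fin P (λ p → φ₀ p + φ₁ p)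
                ≡ Π-Fin P (λ p → trinomial (N + N) (φ₀ p) (φ₁ p)) * (2 ^ (N + N)) ^ P
card𝒜₂-scaled N P φ₀ φ₁ = begin
  card𝒜₂ N P φ₀ φ₁ * 2 ^ Σ-Fin P (λ p → φ₀ p + φ₁ p)
    ≡⟨ cong₂ _*_ (card𝒜₂≡ N P φ₀ φ₁) (sym (Π-Fin-^ 2 P _)) ⟩
  Π-Fin P (λ p → dosageCount (N + N) (φ₀ p) (φ₁ p)) * Π-Fin P (λ p → 2 ^ (φ₀ p + φ₁ p))
    ≡⟨ sym (Π-Fin-* P _ _) ⟩
  Π-Fin P (λ p → dosageCount (N + N) (φ₀ p) (φ₁ p) * 2 ^ (φ₀ p + φ₁ p))
    ≡⟨ Π-Fin-cong P (λ p → dosageCount-closed (N + N) (φ₀ p) (φ₁ p)) ⟩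
  Π-Fin P (λ p → trinomial (N + N) (φ₀ p) (φ₁ p) * 2 ^ (N + N))
    ≡⟨ Π-Fin-* P _ _ ⟩
  Π-Fin P (λ p → trinomial (N + N) (φ₀ p) (φ₁ p)) * Π-Fin P (λ _ → 2 ^ (N + N))
    ≡⟨ cong (Π-Fin P (λ p → trinomial (N + N) (φ₀ p) (φ₁ p)) *_) (Π-Fin-const P _) ⟩
  Π-Fin P (λ p → trinomial (N + N) (φ₀ p) (φ₁ p)) * (2 ^ (N + N)) ^ P ∎

∑-allMatrices-1 : ∀ N P → ∑[ _ ← allMatrices N P ] 1 ≡ (2 ^ (N + N)) ^ P
∑-allMatrices-1 N P = begin
  ∑[ _ ← allMatrices N P ] 1                  ≡⟨ ∑-allVecs-1 (allVecs allBools (P + P)) N ⟩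
  (∑[ _ ← allVecs allBools (P + P) ] 1) ^ N   ≡⟨ cong (_^ N) (∑-allVecs-1 allBools (P + P)) ⟩
  (2 ^ (P + P)) ^ N                           ≡⟨ ^-*-assoc 2 (P + P) N ⟩
  2 ^ ((P + P) * N)                           ≡⟨ cong (2 ^_) (swap-dimensions P N) ⟩
  2 ^ ((N + N) * P)                           ≡⟨ sym (^-*-assoc 2 (N + N) P) ⟩
  (2 ^ (N + N)) ^ P                           ∎
  where
  swap-dimensions : ∀ P N → (P + P) * N ≡ (N + N) * P
  swap-dimensions = solve-∀

card𝒜₁≡ : ∀ N P a → card𝒜₁ N P a ≡ Π-Fin N (λ n → (P + P) C a n) * (2 ^ (N + N)) ^ P
card𝒜₁≡ N P a = begin
  card𝒜₁ N P a
    ≡⟨ length-filter≡∑ (in𝒜₁? {N} {P} a) (allArrays N P) ⟩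
  ∑[ AX ← allArrays N P ] 𝟙 (in𝒜₁? {N} {P} a AX)
    ≡⟨ ∑-cartesianProduct matrices matrices _ ⟩
  ∑[ A ← matrices ] ∑[ X ← matrices ] 𝟙 (in𝒜₁? {N} {P} a (A , X))
    ≡⟨ ∑-cong matrices (λ A → ∑-cong matrices (λ X → trans (𝟙-all? N _) (sym (*-identityʳ _)))) ⟩
  ∑[ A ← matrices ] ∑[ X ← matrices ] (tallies A * 1)
    ≡⟨ ∑-cong matrices (λ A → ∑-*ˡ matrices (tallies A) (λ _ → 1)) ⟩
  ∑[ A ← matrices ] (tallies A * (∑[ _ ← matrices ] 1))
    ≡⟨ ∑-*ʳ matrices _ tallies ⟩
  ∑ matrices tallies * (∑[ _ ← matrices ] 1)
    ≡⟨ cong₂ _*_ (allVecs-factorises rows N (λ n r → 𝟙 (∑ᵥ r bit ≟ a n))) (∑-allMatrices-1 N P) ⟩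
  Π-Fin N (λ n → ∑[ r ← rows ] 𝟙 (∑ᵥ r bit ≟ a n)) * (2 ^ (N + N)) ^ P
    ≡⟨ cong (_* (2 ^ (N + N)) ^ P) (Π-Fin-cong N (λ n → ∑-bitVecs-weight≡C (P + P) (a n))) ⟩
  Π-Fin N (λ n → (P + P) C a n) * (2 ^ (N + N)) ^ P ∎
  where
  rows : List (Vec Bool (P + P))
  rows = allVecs allBools (P + P)
  matrices : List (Matrix N P)
  matrices = allMatrices N P
  tallies : Matrix N P → ℕ
  tallies A = Π-Fin N (λ n → 𝟙 (∑ᵥ (lookup A n) bit ≟ a n))

<⇔<-scaled : ∀ {a b c d} k l .{{_ : NonZero k}} .{{_ : NonZero l}} →
             a * k ≡ c * l → b * k ≡ d * l → (a < b ⇔ c < d)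
<⇔<-scaled {a} {b} {c} {d} k l ak≡cl bk≡dl = mk⇔
  (λ a<b → *-cancelʳ-< l c d (subst₂ _<_ ak≡cl bk≡dl (*-monoˡ-< k a<b)))
  (λ c<d → *-cancelʳ-< k a b (subst₂ _<_ (sym ak≡cl) (sym bk≡dl) (*-monoˡ-< l c<d)))

theorem1 : (N P : ℕ) → 0 < N → 0 < P →
           (a : Fin N → ℕ) → (φ₀ φ₁ : Fin P → ℕ) →
           (∀ n → a n ≤ P + P) →
           (∀ p → φ₀ p + φ₁ p ≤ N + N) →
           (card𝒜₂ N P φ₀ φ₁ < card𝒜₁ N P a)
           ⇔
           (Π-Fin P (λ p → ((N + N) C (φ₀ p + φ₁ p)) * ((φ₀ p + φ₁ p) C φ₁ p))
             < 2 ^ Σ-Fin P (λ p → φ₀ p + φ₁ p) * Π-Fin N (λ n → (P + P) C a n))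
theorem1 N P _ _ a φ₀ φ₁ _ _ =
  <⇔<-scaled (2 ^ Σφ) ((2 ^ (N + N)) ^ P) {{m^n≢0 2 Σφ}} {{m^n≢0 (2 ^ (N + N)) P {{m^n≢0 2 (N + N)}}}}
    (card𝒜₂-scaled N P φ₀ φ₁) card𝒜₁-scaled
  where
  Σφ CA : ℕ
  Σφ = Σ-Fin P (λ p → φ₀ p + φ₁ p)
  CA = Π-Fin N (λ n → (P + P) C a n)
  rotate : ∀ x y z → x * y * z ≡ z * x * y
  rotate = solve-∀
  card𝒜₁-scaled : card𝒜₁ N P a * 2 ^ Σφ ≡ (2 ^ Σφ * CA) * (2 ^ (N + N)) ^ P
  card𝒜₁-scaled = trans (cong (_* 2 ^ Σφ) (card𝒜₁≡ N P a)) (rotate CA ((2 ^ (N + N)) ^ P) (2 ^ Σφ))
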